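{- For every $k$ and every $f\in\mathrm{RPP}^k$ (with any derivation of $f\in\mathrm{RPP}^k$ used to build the encoding), $\vdash_\omega \mathrm{isos}(f) : Z^k\leftrightarrow Z^k$.
   Context: RPP (Reversible Primitive Permutations): $\mathrm{RPP}^k$ is a set of functions $\mathbb{Z}^k\to\mathbb{Z}^k$ defined inductively: the primitives $S,P,\mathrm{Id},\mathrm{Sign}\in\mathrm{RPP}^1$ with $S(x)=x+1$, $P(x)=x-1$, $\mathrm{Id}(x)=x$, $\mathrm{Sign}(x)=-x$, and $\mathcal{X}\in\mathrm{RPP}^2$ with $\mathcal{X}(x,y)=(y,x)$; and for $f,g,h\in\mathrm{RPP}^k$, $j\in\mathrm{RPP}^l$: sequential composition $f;g\in\mathrm{RPP}^k$ ($x\mapsto g(f(x))$), parallel composition $f\parallel j\in\mathrm{RPP}^{k+l}$ ($(\vec x,\vec y)\mapsto(f(\vec x),j(\vec y))$), iteration $\mathbf{It}[f]\in\mathrm{RPP}^{k+1}$ with $\mathbf{It}[f](\vec x,x)=(f^{|x|}(\vec x),x)$, and selection $\mathbf{If}[f,g,h]\in\mathrm{RPP}^{k+1}$ with $\mathbf{If}[f,g,h](\vec x,x)=(f(\vec x),x)$ if $x>0$, $(g(\vec x),x)$ if $x=0$, $(h(\vec x),x)$ if $x<0$. Language: types $A ::= \mathbb{1}\mid A\oplus B\mid A\otimes B\mid\mu X.A\mid X$ (closed); values $v ::= ()\mid x\mid\mathtt{inl}\,v\mid\mathtt{inr}\,v\mid\langle v_1,v_2\rangle\mid\mathtt{fold}\,v$;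 patterns $p::=x\mid\langle p_1,p_2\rangle$; expressions $e::=v\mid\mathtt{let}\,p_1=\omega\,p_2\,\mathtt{in}\,e$; isos $\omega::=\{v_1\leftrightarrow e_1\mid\dots\mid v_n\leftrightarrow e_n\}\mid\mathtt{fix}\,g.\omega\mid g$; $(x_1,\dots,x_n)=\langle x_1,\langle\dots,x_n\rangle\rangle$, $\vec x$ a tuple of distinct variables, $A^n=A\otimes\dots\otimes A$ ($n$ factors, right-nested). Typing of terms $\Delta;\Psi\vdash_e t:A$ ($\Delta$ linear context of term variables, $\Psi$ empty or one iso-variable $g:\alpha$): $\emptyset;\Psi\vdash_e():\mathbb{1}$; $x:A;\Psi\vdash_e x:A$; $\mathtt{inl}/\mathtt{inr}$ into $A\oplus B$ from $A$ resp. $B$; pairs split the context between components into $A\otimes B$; $\mathtt{fold}\,t:\mu X.A$ from $t:A[X\leftarrow\mu X.A]$; $\omega\,t:B$ from $t:A$ and either $\omega=g$ with $\Psi\vdash_\omega g:A\leftrightarrow B$ or $\vdash_\omega\omega:A\leftrightarrow B$ with empty iso-context; $\mathtt{let}\,(x_1,\dots,x_n)=t_1\,\mathtt{in}\,t_2:B$ under $\Delta_1,\Delta_2$ from $\Delta_1;\Psi\vdash_e t_1:A_1\otimes\dots\otimes A_n$ and $\Delta_2,x_1:A_1,\dots,x_n:A_n;\Psi\vdash_e t_2:B$. Typing of isos: $\Psi\vdash_\omega\{v_i\leftrightarrow e_i\}_i:A\leftrightarrow B$ if $\Delta_i\vdash_e v_i:A$, $\Delta_i;\Psi\vdash_e e_i:B$,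 $\mathtt{OD}_A(\{v_i\})$ and $\mathtt{OD}_B(\{Val(e_i)\})$ ($Val$ strips the lets); $g:\alpha\vdash_\omega g:\alpha$; $\Psi\vdash_\omega\mathtt{fix}\,g.\omega:\alpha$ if $g:\alpha\vdash_\omega\omega:\alpha$ and $\mathtt{fix}\,g.\omega$ is structurally recursive, i.e. $\omega=\{v_i\leftrightarrow e_i\}:A_1\otimes\dots\otimes A_m\leftrightarrow C$ and there is $j$ with $A_j=\mu X.B$ such that each $v_i=(v_i^1,\dots,v_i^m)$ and either $v_i^j$ is closed and $e_i$ has no subterm $g\,p$, or every subterm $g\,p$ of $e_i$ has $p=(x_1,\dots,x_m)$ with $x_j$ a strict subterm of $v_i^j$. $\mathtt{OD}_A(S)$: $\mathtt{OD}_A(\{x\})$; $\mathtt{OD}_{\mathbb{1}}(\{()\})$; $\mathtt{OD}_{A\oplus B}(\{\mathtt{inl}\,v\mid v\in S\}\cup\{\mathtt{inr}\,v\mid v\in T\})$ if $\mathtt{OD}_A(S),\mathtt{OD}_B(T)$; $\mathtt{OD}_{\mu X.A}(\{\mathtt{fold}\,v\mid v\in S\})$ if $\mathtt{OD}_{A[X\leftarrow\mu X.A]}(S)$; $\mathtt{OD}_{A\otimes B}(S)$ if either $\mathtt{OD}_A(\pi_1S)$ and $\forall v\in\pi_1 S$, $\mathtt{OD}_B(\{w\mid\langle v,w\rangle\in S\})$, or symmetrically on the second component. Encoding: $\mathrm{npos}=\mu X.\mathbb{1}\oplus X$, $Z=\mathbb{1}\oplus(\mathrm{npos}\oplus\mathrm{npos})$.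 $\mathrm{isos}(f)$ is defined by induction on the derivation of $f\in\mathrm{RPP}^k$: $\mathrm{isos}(\mathrm{Id})=\{x\leftrightarrow x\}$; $\mathrm{isos}(\mathcal{X})=\{(x,y)\leftrightarrow(y,x)\}$; $\mathrm{isos}(\mathrm{Sign})=\{\mathtt{inr}(\mathtt{inl}\,x)\leftrightarrow\mathtt{inr}(\mathtt{inr}\,x)\mid\mathtt{inr}(\mathtt{inr}\,x)\leftrightarrow\mathtt{inr}(\mathtt{inl}\,x)\mid\mathtt{inl}()\leftrightarrow\mathtt{inl}()\}$; $\mathrm{isos}(S)=\{\mathtt{inl}()\leftrightarrow\mathtt{inr}(\mathtt{inl}(\mathtt{fold}(\mathtt{inl}())))\mid\mathtt{inr}(\mathtt{inl}\,x)\leftrightarrow\mathtt{inr}(\mathtt{inl}(\mathtt{fold}(\mathtt{inr}\,x)))\mid\mathtt{inr}(\mathtt{inr}(\mathtt{fold}(\mathtt{inl}())))\leftrightarrow\mathtt{inl}()\mid\mathtt{inr}(\mathtt{inr}(\mathtt{fold}(\mathtt{inr}\,x)))\leftrightarrow\mathtt{inr}(\mathtt{inr}\,x)\}$; $\mathrm{isos}(P)$ is the same set of clauses with the two sides of each clause swapped. With $\omega_f=\mathrm{isos}(f)$ etc.: $\mathrm{isos}(f;g)=\{\vec x\leftrightarrow\mathtt{let}\,\vec y=\omega_f\,\vec x\,\mathtt{in}\,\mathtt{let}\,\vec z=\omega_g\,\vec y\,\mathtt{in}\,\vec z\}$; $\mathrm{isos}(f\parallel g)=\{(x_1,\dots,x_j,y_1,\dots,y_k)\leftrightarrow\mathtt{let}\,(x_1',\dots,x_j')=\omega_f(x_1,\dots,x_j)\,\mathtt{in}\,\mathtt{let}\,(y_1',\dots,y_k')=\omega_g(y_1,\dots,y_k)\,\mathtt{in}\,(x_1',\dots,x_j',y_1',\dots,y_k')\}$;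 for $f\in\mathrm{RPP}^k$, $\omega_{aux}:Z^k\otimes\mathrm{npos}\leftrightarrow Z^k\otimes\mathrm{npos}$ is $\mathtt{fix}\,g.\{(\vec x,\mathtt{fold}(\mathtt{inl}()))\leftrightarrow\mathtt{let}\,\vec y=\omega_f\,\vec x\,\mathtt{in}\,(\vec y,\mathtt{fold}(\mathtt{inl}()))\mid(\vec x,\mathtt{fold}(\mathtt{inr}\,n))\leftrightarrow\mathtt{let}\,\vec y=\omega_f\,\vec x\,\mathtt{in}\,\mathtt{let}\,(\vec z,n')=g\,(\vec y,n)\,\mathtt{in}\,(\vec z,\mathtt{fold}(\mathtt{inr}\,n'))\}$ and $\mathrm{isos}(\mathbf{It}[f])=\{(\vec x,\mathtt{inl}())\leftrightarrow(\vec x,\mathtt{inl}())\mid(\vec x,\mathtt{inr}(\mathtt{inl}\,z))\leftrightarrow\mathtt{let}\,(\vec y,z')=\omega_{aux}(\vec x,z)\,\mathtt{in}\,(\vec y,\mathtt{inr}(\mathtt{inl}\,z'))\mid(\vec x,\mathtt{inr}(\mathtt{inr}\,z))\leftrightarrow\mathtt{let}\,(\vec y,z')=\omega_{aux}(\vec x,z)\,\mathtt{in}\,(\vec y,\mathtt{inr}(\mathtt{inr}\,z'))\}$; $\mathrm{isos}(\mathbf{If}[f,g,h])=\{(\vec x,\mathtt{inr}(\mathtt{inl}\,z))\leftrightarrow\mathtt{let}\,\vec x'=\omega_f\,\vec x\,\mathtt{in}\,(\vec x',\mathtt{inr}(\mathtt{inl}\,z))\mid(\vec x,\mathtt{inl}())\leftrightarrow\mathtt{let}\,\vec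 x'=\omega_g\,\vec x\,\mathtt{in}\,(\vec x',\mathtt{inl}())\mid(\vec x,\mathtt{inr}(\mathtt{inr}\,z))\leftrightarrow\mathtt{let}\,\vec x'=\omega_h\,\vec x\,\mathtt{in}\,(\vec x',\mathtt{inr}(\mathtt{inr}\,z))\}$. In each case $\vec x,\vec y,\vec z,\vec x'$ are tuples of $k$ distinct fresh variables (of the appropriate length). -}

module Defs where

open import Data.Nat using (ℕ; zero; suc; _+_)
open import Data.Fin using (Fin) renaming (zero to fz; suc to fs)
open import Data.Maybe using (Maybe; just; nothing)
open import Data.Product using (Σ; _×_; _,_; proj₁; proj₂; ∃)
open import Data.Sum using (_⊎_)
open import Data.Unit using (⊤)
open import Data.Empty using (⊥)
open import Data.List using (List; []; _∷_; _++_; map; upTo; replicate; _∷ʳ_)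
open import Data.Vec using (Vec; lookup; toList)
import Data.Vec as V
open import Data.List.Membership.Propositional using (_∈_)
open import Data.List.Relation.Unary.Unique.Propositional using (Unique)
open import Data.List.Relation.Ternary.Interleaving.Propositional using (Interleaving)
open import Function.Bundles using (_⇔_)
open import Relation.Binary.PropositionalEquality using (_≡_)

-- RPP (a term of type RPP k is a derivation of f ∈ RPP^k)

data RPP : ℕ → Set where
  S P Id Sign : RPP 1
  𝓧 : RPP 2
  _⨾_ : ∀ {k} → RPP k → RPP k → RPP k
  _∥_ : ∀ {k l} → RPP k → RPP l → RPP (k + l)
  It : ∀ {k} → RPP k → RPP (suc k)
  If : ∀ {k} → RPP k → RPP k → RPP k → RPP (suc k)

-- Types (type variables as de Bruijn indices; Ty 0 = closed types)

data Ty (n : ℕ) : Set where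
  𝟙 : Ty n
  _⊕_ : Ty n → Ty n → Ty n
  _⊗_ : Ty n → Ty n → Ty n
  μ : Ty (suc n) → Ty n
  tv : Fin n → Ty n

renTy : ∀ {n m} → (Fin n → Fin m) → Ty n → Ty m
renTy ρ 𝟙 = 𝟙
renTy ρ (A ⊕ B) = renTy ρ A ⊕ renTy ρ B
renTy ρ (A ⊗ B) = renTy ρ A ⊗ renTy ρ B
renTy ρ (μ A) = μ (renTy ext A)
  where
  ext : Fin (suc _) → Fin (suc _)
  ext fz = fz
  ext (fs i) = fs (ρ i)
renTy ρ (tv i) = tv (ρ i)

subTy : ∀ {n m} → (Fin n → Ty m) → Ty n → Ty m
subTy σ 𝟙 = 𝟙
subTy σ (A ⊕ B) = subTy σ A ⊕ subTy σ B
subTy σ (A ⊗ B) = subTy σ A ⊗ subTy σ B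
subTy σ (μ A) = μ (subTy ext A)
  where
  ext : Fin (suc _) → Ty (suc _)
  ext fz = tv fz
  ext (fs i) = renTy fs (σ i)
subTy σ (tv i) = σ i

unfoldTy : Ty 1 → Ty 0
unfoldTy A = subTy (λ _ → μ A) A

tyTup : List (Ty 0) → Ty 0
tyTup [] = 𝟙
tyTup (A ∷ []) = A
tyTup (A ∷ As) = A ⊗ tyTup As

npos : Ty 0
npos = μ (𝟙 ⊕ tv fz)

Z : Ty 0
Z = 𝟙 ⊕ (npos ⊕ npos)

Zpow : ℕ → Ty 0
Zpow k = tyTup (replicate k Z)

Name : Set
Name = ℕ × ℕ

data Val : Set where
  unit : Val
  var : Name → Val
  inl inr : Val → Val
  pair : Val → Val → Val
  fold : Val → Val

data Pat : Set where
  pvar : Name → Pat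
  ppair : Pat → Pat → Pat

⌜_⌝ : Pat → Val
⌜ pvar x ⌝ = var x
⌜ ppair p q ⌝ = pair ⌜ p ⌝ ⌜ q ⌝

mutual
  data Expr : Set where
    ret : Val → Expr
    -- let p₁ = ω p₂ in e
    lett : Pat → Iso → Pat → Expr → Expr

  data Iso : Set where
    clauses : List (Val × Expr) → Iso
    -- fix g.ω ; the bound iso-variable g is anonymous (de Bruijn style):
    -- 'ivar' refers to the innermost enclosing fix
    fix : Iso → Iso
    ivar : Iso

valOf : Expr → Val
valOf (ret v) = v
valOf (lett _ _ _ e) = valOf e

tupV : List Val → Val
tupV [] = unit
tupV (v ∷ []) = v
tupV (v ∷ vs) = pair v (tupV vs)

-- tuples of variables as patterns (the empty case never arises: RPP^0 is empty)
tupP : List Name → Pat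
tupP [] = pvar (0 , 0)
tupP (x ∷ []) = pvar x
tupP (x ∷ xs) = ppair (pvar x) (tupP xs)

Ctx : Set
Ctx = List (Name × Ty 0)

UniqueNames : Ctx → Set
UniqueNames Δ = Unique (map proj₁ Δ)

-- iso-context: empty or a single iso-variable g : A ↔ B
Psi : Set
Psi = Maybe (Ty 0 × Ty 0)

-- typing of values (Δ ⊢ v : A); Δ₁,Δ₂ is an interleaving with disjoint names
data VTy : Ctx → Val → Ty 0 → Set where
  tyUnit : VTy [] unit 𝟙
  tyVar : ∀ {x A} → VTy ((x , A) ∷ []) (var x) A
  tyInl : ∀ {Δ v A B} → VTy Δ v A → VTy Δ (inl v) (A ⊕ B)
  tyInr : ∀ {Δ v A B} → VTy Δ v B → VTy Δ (inr v) (A ⊕ B)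
  tyPair : ∀ {Δ Δ₁ Δ₂ v w A B} → Interleaving Δ₁ Δ₂ Δ → UniqueNames Δ →
           VTy Δ₁ v A → VTy Δ₂ w B → VTy Δ (pair v w) (A ⊗ B)
  tyFold : ∀ {Δ v A} → VTy Δ v (unfoldTy A) → VTy Δ (fold v) (μ A)

_≈ₛ_ : List Val → (Val → Set) → Set
L ≈ₛ Q = ∀ v → (v ∈ L) ⇔ Q v

-- OD_A(S), S a finite set of values represented by a list
data OD : Ty 0 → List Val → Set where
  odVar : ∀ {A L} x → L ≈ₛ (λ v → v ≡ var x) → OD A L
  odUnit : ∀ {L} → L ≈ₛ (λ v → v ≡ unit) → OD 𝟙 L
  odSum : ∀ {A B L L₁ L₂} → OD A L₁ → OD B L₂ →
          L ≈ₛ (λ v → (Σ Val λ u → u ∈ L₁ × v ≡ inl u) ⊎ (Σ Val λ u → u ∈ L₂ × v ≡ inr u)) →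
          OD (A ⊕ B) L
  odFold : ∀ {A L L₁} → OD (unfoldTy A) L₁ →
           L ≈ₛ (λ v → Σ Val λ u → u ∈ L₁ × v ≡ fold u) → OD (μ A) L
  odTensorˡ : ∀ {A B L L₁} →
           (∀ u → u ∈ L → Σ Val λ v → Σ Val λ w → u ≡ pair v w) →
           L₁ ≈ₛ (λ v → Σ Val λ w → pair v w ∈ L) → OD A L₁ →
           (∀ v → v ∈ L₁ → Σ (List Val) λ T → (T ≈ₛ (λ w → pair v w ∈ L)) × OD B T) →
           OD (A ⊗ B) L
  odTensorʳ : ∀ {A B L L₂} →
           (∀ u → u ∈ L → Σ Val λ v → Σ Val λ w → u ≡ pair v w) →
           L₂ ≈ₛ (λ w → Σ Val λ v → pair v w ∈ L) → OD B L₂ →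
           (∀ w → w ∈ L₂ → Σ (List Val) λ T → (T ≈ₛ (λ v → pair v w ∈ L)) × OD A T) →
           OD (A ⊗ B) L

Closed : Val → Set
Closed unit = ⊤
Closed (var _) = ⊥
Closed (inl v) = Closed v
Closed (inr v) = Closed v
Closed (pair v w) = Closed v × Closed w
Closed (fold v) = Closed v

data Sub (u : Val) : Val → Set where
  here : Sub u u
  inSub-l : ∀ {v} → Sub u v → Sub u (inl v)
  inSub-r : ∀ {v} → Sub u v → Sub u (inr v)
  inSub-p1 : ∀ {v w} → Sub u v → Sub u (pair v w)
  inSub-p2 : ∀ {v w} → Sub u w → Sub u (pair v w)
  inSub-f : ∀ {v} → Sub u v → Sub u (fold v)

data StrictSub (u : Val) : Val → Set where
  ss-l : ∀ {v} → Sub u v → StrictSub u (inl v)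
  ss-r : ∀ {v} → Sub u v → StrictSub u (inr v)
  ss-p1 : ∀ {v w} → Sub u v → StrictSub u (pair v w)
  ss-p2 : ∀ {v w} → Sub u w → StrictSub u (pair v w)
  ss-f : ∀ {v} → Sub u v → StrictSub u (fold v)

AllCalls : (Pat → Set) → Expr → Set
AllCalls Q (ret v) = ⊤
AllCalls Q (lett p₁ ivar p₂ e) = Q p₂ × AllCalls Q e
AllCalls Q (lett p₁ (clauses _) p₂ e) = AllCalls Q e
AllCalls Q (lett p₁ (fix _) p₂ e) = AllCalls Q e

NoCall : Expr → Set
NoCall = AllCalls (λ _ → ⊥)

IsMu : Ty 0 → Set
IsMu (μ _) = ⊤
IsMu _ = ⊥

StructRec : Iso → Ty 0 → Set
StructRec (clauses cs) A =
  Σ ℕ λ m → Σ (Vec (Ty 0) (suc m)) λ As → A ≡ tyTup (toList As) ×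
  Σ (Fin (suc m)) λ j → IsMu (lookup As j) ×
  (∀ {v e} → (v , e) ∈ cs →
     Σ (Vec Val (suc m)) λ vs → v ≡ tupV (toList vs) ×
     ((Closed (lookup vs j) × NoCall e) ⊎
      AllCalls (λ p → Σ (Vec Name (suc m)) λ xs → p ≡ tupP (toList xs) ×
                        StrictSub (var (lookup xs j)) (lookup vs j)) e))
StructRec (fix _) A = ⊥
StructRec ivar A = ⊥

mutual
  data ETy : Ctx → Psi → Expr → Ty 0 → Set where
    tyRet : ∀ {Δ Ψ v C} → VTy Δ v C → ETy Δ Ψ (ret v) C
    tyLet : ∀ {Δ Δ₁ Δ₂ Γ Θ Ψ p₁ ω p₂ e A B C} →
            Interleaving Δ₁ Δ₂ Δ → UniqueNames Δ →
            VTy Δ₁ ⌜ p₂ ⌝ A → AppTy Ψ ω A B →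
            VTy Γ ⌜ p₁ ⌝ B → Interleaving Δ₂ Γ Θ → UniqueNames Θ →
            ETy Θ Ψ e C → ETy Δ Ψ (lett p₁ ω p₂ e) C

  data AppTy : Psi → Iso → Ty 0 → Ty 0 → Set where
    appVar : ∀ {A B} → AppTy (just (A , B)) ivar A B
    appClosed : ∀ {Ψ ω A B} → ITy nothing ω A B → AppTy Ψ ω A B

  data ITy : Psi → Iso → Ty 0 → Ty 0 → Set where
    tyClauses : ∀ {Ψ cs A B} →
      (∀ {v e} → (v , e) ∈ cs → Σ Ctx λ Δ → VTy Δ v A × ETy Δ Ψ e B) →
      OD A (map proj₁ cs) → OD B (map (λ c → valOf (proj₂ c)) cs) →
      ITy Ψ (clauses cs) A B
    tyIVar : ∀ {A B} → ITy (just (A , B)) ivar A B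
    tyFix : ∀ {Ψ ω A B} → ITy (just (A , B)) ω A B → StructRec ω A →
      ITy Ψ (fix ω) A B

-- fresh variables: tag t, indices 0..k-1
vars : ℕ → ℕ → List Name
vars t k = map (λ i → (t , i)) (upTo k)

vs : List Name → List Val
vs = map var

z₀ : Val
z₀ = fold (inl unit)

isos : ∀ {k} → RPP k → Iso
isos Id = clauses ((var (0 , 0) , ret (var (0 , 0))) ∷ [])
isos 𝓧 = clauses ((tupV (var x ∷ var y ∷ []) , ret (tupV (var y ∷ var x ∷ []))) ∷ [])
  where x = (0 , 0) ; y = (1 , 0)
isos Sign = clauses
  ( (inr (inl (var x)) , ret (inr (inr (var x))))
  ∷ (inr (inr (var x)) , ret (inr (inl (var x))))
  ∷ (inl unit , ret (inl unit)) ∷ [])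
  where x = (0 , 0)
isos S = clauses
  ( (inl unit , ret (inr (inl (fold (inl unit)))))
  ∷ (inr (inl (var x)) , ret (inr (inl (fold (inr (var x))))))
  ∷ (inr (inr (fold (inl unit))) , ret (inl unit))
  ∷ (inr (inr (fold (inr (var x)))) , ret (inr (inr (var x)))) ∷ [])
  where x = (0 , 0)
isos P = clauses
  ( (inr (inl (fold (inl unit))) , ret (inl unit))
  ∷ (inr (inl (fold (inr (var x)))) , ret (inr (inl (var x))))
  ∷ (inl unit , ret (inr (inr (fold (inl unit)))))
  ∷ (inr (inr (var x)) , ret (inr (inr (fold (inr (var x)))))) ∷ [])
  where x = (0 , 0)
isos {k} (f ⨾ g) = clauses
  ((tupV (vs xs) , lett (tupP ys) (isos f) (tupP xs) (lett (tupP zs) (isos g) (tupP ys) (ret (tupV (vs zs))))) ∷ [])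
  where xs = vars 0 k ; ys = vars 1 k ; zs = vars 2 k
isos (_∥_ {j} {k} f g) = clauses
  ((tupV (vs (xs ++ ys)) ,
    lett (tupP xs') (isos f) (tupP xs) (lett (tupP ys') (isos g) (tupP ys) (ret (tupV (vs (xs' ++ ys')))))) ∷ [])
  where xs = vars 0 j ; ys = vars 1 k ; xs' = vars 2 j ; ys' = vars 3 k
isos (It {k} f) = clauses
  ( (tupV (vs xs ∷ʳ inl unit) , ret (tupV (vs xs ∷ʳ inl unit)))
  ∷ (tupV (vs xs ∷ʳ inr (inl (var z))) ,
      lett (tupP (ys ∷ʳ z')) aux (tupP (xs ∷ʳ z)) (ret (tupV (vs ys ∷ʳ inr (inl (var z'))))))
  ∷ (tupV (vs xs ∷ʳ inr (inr (var z))) ,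
      lett (tupP (ys ∷ʳ z')) aux (tupP (xs ∷ʳ z)) (ret (tupV (vs ys ∷ʳ inr (inr (var z')))))) ∷ [])
  where
  xs = vars 0 k ; ys = vars 1 k ; z = (2 , 0) ; z' = (3 , 0)
  -- ω_aux : Z^k ⊗ npos ↔ Z^k ⊗ npos  (flattened: Z ⊗ … ⊗ Z ⊗ npos)
  aux : Iso
  aux = fix (clauses
    ( (tupV (vs xs ∷ʳ z₀) , lett (tupP ys) (isos f) (tupP xs) (ret (tupV (vs ys ∷ʳ z₀))))
    ∷ (tupV (vs xs ∷ʳ fold (inr (var n))) ,
        lett (tupP ys) (isos f) (tupP xs)
          (lett (tupP (zs ∷ʳ n')) ivar (tupP (ys ∷ʳ n)) (ret (tupV (vs zs ∷ʳ fold (inr (var n'))))))) ∷ []))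
    where zs = vars 2 k ; n = (4 , 0) ; n' = (5 , 0)
isos (If {k} f g h) = clauses
  ( (tupV (vs xs ∷ʳ inr (inl (var z))) , lett (tupP xs') (isos f) (tupP xs) (ret (tupV (vs xs' ∷ʳ inr (inl (var z))))))
  ∷ (tupV (vs xs ∷ʳ inl unit) , lett (tupP xs') (isos g) (tupP xs) (ret (tupV (vs xs' ∷ʳ inl unit))))
  ∷ (tupV (vs xs ∷ʳ inr (inr (var z))) , lett (tupP xs') (isos h) (tupP xs) (ret (tupV (vs xs' ∷ʳ inr (inr (var z)))))) ∷ [])
  where xs = vars 0 k ; xs' = vars 1 k ; z = (2 , 0)

-- Every RPP arity is positive, so every encoding
-- manipulates nonempty tuples of variables. The clauses of the composite encodings are tuples
-- of distinct variables ending in one value, and their last values are pairwise distinct;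
-- orthogonality then follows by splitting off one variable column at a time, since the tail
-- of a clause determines the clause and hence its leading variable. The only recursive iso,
-- ω_aux, calls itself on the counter n of fold (inr n), so it is structurally recursive.
-- Finally isos P is syntactically the reversal of isos S, and reversing a let-free iso
-- preserves its typing.
module Submission where

open import Defs
open import Data.Nat using (ℕ; zero; suc; _+_)
open import Data.Nat.Properties using (suc-injective)
open import Data.Fin using (fromℕ)
open import Data.Maybe using (just; nothing)
open import Data.Product using (Σ; ∃; ∃₂; _×_; _,_; proj₁; proj₂; uncurry; map₂)
open import Data.Sum using (inj₁; inj₂)
import Data.Sum as Sum
open import Data.Unit using (tt)
open import Data.Empty using (⊥-elim)
open import Data.List using (List; []; _∷_; _++_; map; replicate; upTo; _∷ʳ_; length; drop)
open import Data.List.Properties using (length-map; length-upTo; length-++; length-replicate; map-∘; map-++)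
open import Data.List.Membership.Propositional using (_∈_)
open import Data.List.Membership.Propositional.Properties using (∈-map⁺; ∈-map⁻; ∈-++⁺ˡ; ∈-++⁺ʳ; ∈-++⁻)
open import Data.List.Relation.Unary.Any using (here; there)
open import Data.List.Relation.Unary.Any.Properties using (singleton⁻)
open import Data.List.Relation.Unary.All using (All; []; _∷_)
import Data.List.Relation.Unary.All as All
import Data.List.Relation.Unary.All.Properties as All
open import Data.List.Relation.Unary.Unique.Propositional using (Unique)
open import Data.List.Relation.Unary.AllPairs using ([]; _∷_)
import Data.List.Relation.Unary.Unique.Propositional.Properties as Unique
open import Data.List.Relation.Binary.Subset.Propositional using (_⊆_)
open import Data.List.Relation.Binary.Permutation.Propositional using (_↭_; ↭-sym)
open import Data.List.Relation.Binary.Permutation.Propositional.Properties using (∈-resp-↭; shift; ↭-reverse)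
import Data.List.Relation.Binary.Pointwise as Pointwise
open import Data.List.Relation.Ternary.Interleaving.Propositional using (Interleaving; consˡ; consʳ; left; right; swap)
open import Data.List.Relation.Ternary.Interleaving.Properties using (++-disjoint)
open import Data.Vec using (Vec; lookup; toList)
import Data.Vec as Vec
open import Function using (id)
open import Function.Bundles using (mk⇔; Equivalence)
open import Relation.Binary.PropositionalEquality using (_≡_; _≢_; refl; sym; trans; cong; cong₂; subst; subst₂)

arity-suc : ∀ {k} → RPP k → ∃ λ m → k ≡ suc m
arity-suc S = 0 , refl
arity-suc P = 0 , refl
arity-suc Id = 0 , refl
arity-suc Sign = 0 , refl
arity-suc 𝓧 = 1 , refl
arity-suc (f ⨾ g) = arity-suc f
arity-suc (f ∥ g) with arity-suc f
... | _ , refl = _ , refl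
arity-suc (It f) = _ , refl
arity-suc (If f g h) = _ , refl

_^_ : Ty 0 → ℕ → Ty 0
A ^ k = tyTup (replicate k A)

_^_▸_ : Ty 0 → ℕ → Ty 0 → Ty 0
A ^ k ▸ B = tyTup (replicate k A ∷ʳ B)

^-▸-suc : ∀ A n B → A ^ suc n ▸ B ≡ A ⊗ (A ^ n ▸ B)
^-▸-suc A zero B = refl
^-▸-suc A (suc n) B = refl

^-▸-self : ∀ A k → A ^ k ▸ A ≡ A ^ suc k
^-▸-self A zero = refl
^-▸-self A (suc k) = trans (^-▸-suc A k A) (cong (A ⊗_) (^-▸-self A k))

-- Linear contexts and tuples of variables

varTup : List Name → Val
varTup xs = tupV (map var xs)

row : List Name → Val → Val
row xs l = tupV (map var xs ∷ʳ l)

row-∷ : ∀ x xs l → row (x ∷ xs) l ≡ pair (var x) (row xs l)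
row-∷ x [] l = refl
row-∷ x (y ∷ ys) l = refl

pair-var-injective : ∀ {x y t u} → pair (var x) t ≡ pair (var y) u → x ≡ y × t ≡ u
pair-var-injective refl = refl , refl

row-injectiveʳ : ∀ xs ys {l l′} → length xs ≡ length ys → row xs l ≡ row ys l′ → l ≡ l′
row-injectiveʳ [] [] _ e = e
row-injectiveʳ (x ∷ xs) (y ∷ ys) {l} {l′} len e =
  row-injectiveʳ xs ys (suc-injective len)
    (proj₂ (pair-var-injective (trans (sym (row-∷ x xs l)) (trans e (row-∷ y ys l′)))))

⌜tupP⌝-∷ : ∀ x xs → ⌜ tupP (x ∷ xs) ⌝ ≡ varTup (x ∷ xs)
⌜tupP⌝-∷ x [] = refl
⌜tupP⌝-∷ x (y ∷ ys) = cong (pair (var x)) (⌜tupP⌝-∷ y ys)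

⌜tupP⌝-∷ʳ : ∀ xs z → ⌜ tupP (xs ∷ʳ z) ⌝ ≡ row xs (var z)
⌜tupP⌝-∷ʳ [] z = refl
⌜tupP⌝-∷ʳ (x ∷ []) z = refl
⌜tupP⌝-∷ʳ (x ∷ y ∷ ys) z = cong (pair (var x)) (⌜tupP⌝-∷ʳ (y ∷ ys) z)

length-vars : ∀ t k → length (vars t k) ≡ k
length-vars t k = trans (length-map _ (upTo k)) (length-upTo k)

length-vars-++ : ∀ t s j k → length (vars t j ++ vars s k) ≡ j + k
length-vars-++ t s j k = trans (length-++ (vars t j)) (cong₂ _+_ (length-vars t j) (length-vars s k))

vars-unique : ∀ t k → Unique (vars t k)
vars-unique t k = Unique.map⁺ (λ { refl → refl }) (Unique.upTo⁺ k)

vars-++-unique : ∀ {t s} → t ≢ s → ∀ j k → Unique (vars t j ++ vars s k)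
vars-++-unique {t} {s} t≢s j k = Unique.++⁺ (vars-unique t j) (vars-unique s k) disjoint
  where
  tag : ∀ {u x} n → x ∈ vars u n → proj₁ x ≡ u
  tag n m with ∈-map⁻ _ m
  ... | _ , _ , refl = refl
  disjoint : ∀ {x} → x ∈ vars t j × x ∈ vars s k → _
  disjoint (m₁ , m₂) = t≢s (trans (sym (tag j m₁)) (tag k m₂))

varCtx : Ty 0 → List Name → Ctx
varCtx A = map (_, A)

names-varCtx : ∀ A xs → map proj₁ (varCtx A xs) ≡ xs
names-varCtx A [] = refl
names-varCtx A (x ∷ xs) = cong (x ∷_) (names-varCtx A xs)

varCtx-unique : ∀ {A xs} → Unique xs → UniqueNames (varCtx A xs)
varCtx-unique {A} {xs} = subst Unique (sym (names-varCtx A xs))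

varCtx-++-unique : ∀ {A B} xs ys → Unique (xs ++ ys) → UniqueNames (varCtx A xs ++ varCtx B ys)
varCtx-++-unique {A} {B} xs ys = subst Unique (sym names)
  where
  names : map proj₁ (varCtx A xs ++ varCtx B ys) ≡ xs ++ ys
  names = trans (map-++ proj₁ (varCtx A xs) (varCtx B ys))
                (cong₂ _++_ (names-varCtx A xs) (names-varCtx B ys))

varCtx-vars-unique : ∀ {A B} t s → t ≢ s → ∀ j k →
                     UniqueNames (varCtx A (vars t j) ++ varCtx B (vars s k))
varCtx-vars-unique t s t≢s j k = varCtx-++-unique (vars t j) (vars s k) (vars-++-unique t≢s j k)

interleave-[]ˡ : ∀ {Δ : Ctx} → Interleaving [] Δ Δ
interleave-[]ˡ = right (Pointwise.refl refl)

interleave-[]ʳ : ∀ {Δ : Ctx} → Interleaving Δ [] Δ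
interleave-[]ʳ = left (Pointwise.refl refl)

interleave-++ : ∀ {Δ Δ′ : Ctx} → Interleaving Δ Δ′ (Δ ++ Δ′)
interleave-++ = ++-disjoint interleave-[]ʳ interleave-[]ˡ

varCtx-++-interleave : ∀ {A} xs ys → Interleaving (varCtx A xs) (varCtx A ys) (varCtx A (xs ++ ys))
varCtx-++-interleave xs ys = subst (Interleaving _ _) (sym (map-++ _ xs ys)) interleave-++

varTup-typed : ∀ {A k} xs → length xs ≡ k → UniqueNames (varCtx A xs) →
               VTy (varCtx A xs) (varTup xs) (A ^ k)
varTup-typed [] refl _ = tyUnit
varTup-typed (x ∷ []) refl _ = tyVar
varTup-typed (x ∷ y ∷ ys) refl u@(_ ∷ u′) =
  tyPair (consˡ interleave-[]ˡ) u tyVar (varTup-typed (y ∷ ys) refl u′)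

row-typed : ∀ {A B k Δ l} xs → length xs ≡ k → VTy Δ l B → UniqueNames (varCtx A xs ++ Δ) →
            VTy (varCtx A xs ++ Δ) (row xs l) (A ^ k ▸ B)
row-typed [] refl l⊢ _ = l⊢
row-typed (x ∷ []) refl l⊢ u = tyPair (consˡ interleave-[]ˡ) u tyVar l⊢
row-typed (x ∷ y ∷ ys) refl l⊢ u@(_ ∷ u′) =
  tyPair (consˡ interleave-[]ˡ) u tyVar (row-typed (y ∷ ys) refl l⊢ u′)

vars-row-typed : ∀ {A B Δ l} t k → VTy Δ l B → UniqueNames (varCtx A (vars t k) ++ Δ) →
                 VTy (varCtx A (vars t k) ++ Δ) (row (vars t k) l) (A ^ k ▸ B)
vars-row-typed t k = row-typed (vars t k) (length-vars t k)

vars-row-typed-^suc : ∀ {A Δ l} t k → VTy Δ l A → UniqueNames (varCtx A (vars t k) ++ Δ) →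
                      VTy (varCtx A (vars t k) ++ Δ) (row (vars t k) l) (A ^ suc k)
vars-row-typed-^suc {A} t k l⊢ u = subst (VTy _ _) (^-▸-self A k) (vars-row-typed t k l⊢ u)

vars-pat-typed : ∀ {A} t m →
                 VTy (varCtx A (vars t (suc m))) ⌜ tupP (vars t (suc m)) ⌝ (A ^ suc m)
vars-pat-typed {A} t m =
  subst (λ v → VTy (varCtx A (vars t (suc m))) v (A ^ suc m)) (sym (⌜tupP⌝-∷ _ _))
    (varTup-typed (vars t (suc m)) (length-vars t (suc m)) (varCtx-unique (vars-unique t (suc m))))

vars-∷ʳ-pat-typed : ∀ {A B} t k z → UniqueNames (varCtx A (vars t k) ++ varCtx B (z ∷ [])) →
                    VTy (varCtx A (vars t k) ++ varCtx B (z ∷ [])) ⌜ tupP (vars t k ∷ʳ z) ⌝ (A ^ k ▸ B)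
vars-∷ʳ-pat-typed {A} {B} t k z u =
  subst (λ v → VTy (varCtx A (vars t k) ++ varCtx B (z ∷ [])) v (A ^ k ▸ B))
    (sym (⌜tupP⌝-∷ʳ (vars t k) z)) (vars-row-typed t k tyVar u)

⊢let-vars : ∀ {Ψ ω e C A Δ Δ₀ Θ} t s m → AppTy Ψ ω (A ^ suc m) (A ^ suc m) →
            Interleaving (varCtx A (vars t (suc m))) Δ Δ₀ → UniqueNames Δ₀ →
            Interleaving Δ (varCtx A (vars s (suc m))) Θ → UniqueNames Θ → ETy Θ Ψ e C →
            ETy Δ₀ Ψ (lett (tupP (vars s (suc m))) ω (tupP (vars t (suc m))) e) C
⊢let-vars t s m ω⊢ i₀ u₀ i u e⊢ = tyLet i₀ u₀ (vars-pat-typed t m) ω⊢ (vars-pat-typed s m) i u e⊢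

-- Orthogonal decomposition

≈ₛ-resp : ∀ {L L′ Q Q′} → L ⊆ L′ → L′ ⊆ L → (∀ {v} → Q v → Q′ v) → (∀ {v} → Q′ v → Q v) →
          L ≈ₛ Q → L′ ≈ₛ Q′
≈ₛ-resp L⊆L′ L′⊆L Q⇒Q′ Q′⇒Q L≈Q v =
  mk⇔ (λ m → Q⇒Q′ (Equivalence.to (L≈Q v) (L′⊆L m))) (λ q → L⊆L′ (Equivalence.from (L≈Q v) (Q′⇒Q q)))

OD-resp : ∀ {A L L′} → L ⊆ L′ → L′ ⊆ L → OD A L → OD A L′
OD-resp sub sup (odVar x e) = odVar x (≈ₛ-resp sub sup id id e)
OD-resp sub sup (odUnit e) = odUnit (≈ₛ-resp sub sup id id e)
OD-resp sub sup (odSum a b e) = odSum a b (≈ₛ-resp sub sup id id e)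
OD-resp sub sup (odFold a e) = odFold a (≈ₛ-resp sub sup id id e)
OD-resp sub sup (odTensorˡ pairs e o column) =
  odTensorˡ (λ u m → pairs u (sup m)) (≈ₛ-resp id id (map₂ sub) (map₂ sup) e) o
    (λ v m → let (T , eT , oT) = column v m in T , ≈ₛ-resp id id sub sup eT , oT)
OD-resp sub sup (odTensorʳ pairs e o column) =
  odTensorʳ (λ u m → pairs u (sup m)) (≈ₛ-resp id id (map₂ sub) (map₂ sup) e) o
    (λ v m → let (T , eT , oT) = column v m in T , ≈ₛ-resp id id sub sup eT , oT)

OD-resp-↭ : ∀ {A L L′} → L ↭ L′ → OD A L → OD A L′
OD-resp-↭ p = OD-resp (∈-resp-↭ p) (∈-resp-↭ (↭-sym p))

OD-var : ∀ {A} x → OD A (var x ∷ [])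
OD-var x = odVar x (λ v → mk⇔ singleton⁻ here)

OD-unit : OD 𝟙 (unit ∷ [])
OD-unit = odUnit (λ v → mk⇔ singleton⁻ here)

OD-⊕ : ∀ {A B L₁ L₂} → OD A L₁ → OD B L₂ → OD (A ⊕ B) (map inl L₁ ++ map inr L₂)
OD-⊕ {L₁ = L₁} a b = odSum a b λ v →
  mk⇔ (λ m → Sum.map (∈-map⁻ inl) (∈-map⁻ inr) (∈-++⁻ (map inl L₁) m))
      λ { (inj₁ (_ , m , refl)) → ∈-++⁺ˡ (∈-map⁺ inl m)
        ; (inj₂ (_ , m , refl)) → ∈-++⁺ʳ (map inl L₁) (∈-map⁺ inr m) }

OD-μ : ∀ {A L} → OD (unfoldTy A) L → OD (μ A) (map fold L)
OD-μ a = odFold a λ v → mk⇔ (∈-map⁻ fold) λ { (_ , m , refl) → ∈-map⁺ fold m }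

OD-⊗-column : ∀ {A B} L T →
  (∀ {u} → u ∈ L → ∃₂ λ x t → u ≡ pair (var x) t × t ∈ T) →
  (∀ {t} → t ∈ T → ∃ λ x → pair (var x) t ∈ L) →
  (∀ {x y t} → pair (var x) t ∈ L → pair (var y) t ∈ L → x ≡ y) →
  OD B T → OD (A ⊗ B) L
OD-⊗-column L T split covered functional oT = odTensorʳ pairs tails oT column
  where
  pairs : ∀ u → u ∈ L → Σ Val λ v → Σ Val λ w → u ≡ pair v w
  pairs u m = let (x , t , e , _) = split m in var x , t , e
  tails : T ≈ₛ (λ t → Σ Val λ v → pair v t ∈ L)
  tails t = mk⇔ (λ m → let (x , xt∈) = covered m in var x , xt∈) λ { (v , m) → tail∈ (split m) }
    where
    tail∈ : ∀ {v} → (∃₂ λ x t′ → pair v t ≡ pair (var x) t′ × t′ ∈ T) → t ∈ T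
    tail∈ (_ , _ , refl , m) = m
  column : ∀ t → t ∈ T → Σ (List Val) λ S → (S ≈ₛ λ v → pair v t ∈ L) × OD _ S
  column t m with covered m
  ... | x , xt∈ =
    var x ∷ [] , (λ v → mk⇔ (λ { (here refl) → xt∈ }) (λ vt∈ → here (leading vt∈ (split vt∈)))) , OD-var x
    where
    leading : ∀ {v} → pair v t ∈ L → (∃₂ λ y t′ → pair v t ≡ pair (var y) t′ × t′ ∈ T) → v ≡ var x
    leading vt∈ (y , _ , refl , _) = cong var (functional vt∈ xt∈)

OD-varTup : ∀ {A k} xs → length xs ≡ k → OD (A ^ k) (varTup xs ∷ [])
OD-varTup [] refl = OD-unit
OD-varTup (x ∷ []) refl = OD-var x
OD-varTup (x ∷ y ∷ ys) refl = OD-⊗-column _ _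
  (λ { (here refl) → x , _ , refl , here refl ; (there ()) })
  (λ { (here refl) → x , here refl ; (there ()) })
  (λ { (here refl) (here refl) → refl ; (there ()) _ ; _ (there ()) })
  (OD-varTup (y ∷ ys) refl)

unique-map-injective : ∀ {A B : Set} {f : A → B} {xs x y} →
                       Unique (map f xs) → x ∈ xs → y ∈ xs → f x ≡ f y → x ≡ y
unique-map-injective _ (here refl) (here refl) _ = refl
unique-map-injective {f = f} (fx∉ ∷ _) (here refl) (there y∈) e =
  ⊥-elim (All.lookup fx∉ (∈-map⁺ f y∈) e)
unique-map-injective {f = f} (fy∉ ∷ _) (there x∈) (here refl) e =
  ⊥-elim (All.lookup fy∉ (∈-map⁺ f x∈) (sym e))
unique-map-injective (_ ∷ u) (there x∈) (there y∈) e = unique-map-injective u x∈ y∈ e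

Row : Set
Row = List Name × Val

Width : ℕ → List Row → Set
Width n = All (λ r → length (proj₁ r) ≡ n)

tailRow : Row → Row
tailRow (xs , l) = drop 1 xs , l

rows-width-0 : ∀ {Rs} → Width 0 Rs → map (uncurry row) Rs ≡ map proj₂ Rs
rows-width-0 [] = refl
rows-width-0 {([] , l) ∷ _} (_ ∷ ws) = cong (l ∷_) (rows-width-0 ws)

OD-rows : ∀ {A B} n Rs → Width n Rs → Unique (map proj₂ Rs) → OD B (map proj₂ Rs) →
          OD (A ^ n ▸ B) (map (uncurry row) Rs)
OD-rows zero Rs ws _ oB = subst (OD _) (sym (rows-width-0 ws)) oB
OD-rows {A} {B} (suc n) Rs ws distinct oB =
  subst (λ C → OD C (map (uncurry row) Rs)) (sym (^-▸-suc A n B))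
    (OD-⊗-column _ _ split covered functional
      (OD-rows n (map tailRow Rs) (All.map⁺ (All.map (λ {r} → tail-width {r}) ws))
        (subst Unique (map-∘ Rs) distinct) (subst (OD B) (map-∘ Rs) oB)))
  where
  L = map (uncurry row) Rs
  T = map (uncurry row) (map tailRow Rs)
  tail-width : ∀ {r} → length (proj₁ r) ≡ suc n → length (proj₁ (tailRow r)) ≡ n
  tail-width {_ ∷ _ , _} e = suc-injective e
  wide : ∀ {ns l} → (ns , l) ∈ Rs → ∃₂ λ x xs → ns ≡ x ∷ xs × length xs ≡ n
  wide {[]} r∈ with All.lookup ws r∈
  ... | ()
  wide {x ∷ xs} r∈ = x , xs , refl , suc-injective (All.lookup ws r∈)
  split : ∀ {u} → u ∈ L → ∃₂ λ x t → u ≡ pair (var x) t × t ∈ T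
  split m with ∈-map⁻ (uncurry row) m
  ... | (_ , l) , r∈ , refl with wide r∈
  ... | x , xs , refl , _ = x , row xs l , row-∷ x xs l , ∈-map⁺ (uncurry row) (∈-map⁺ tailRow r∈)
  covered : ∀ {t} → t ∈ T → ∃ λ x → pair (var x) t ∈ L
  covered m with ∈-map⁻ (uncurry row) m
  ... | _ , r′∈ , refl with ∈-map⁻ tailRow r′∈
  ... | (_ , l) , r∈ , refl with wide r∈
  ... | x , xs , refl , _ = x , subst (_∈ L) (row-∷ x xs l) (∈-map⁺ (uncurry row) r∈)
  functional : ∀ {x y t} → pair (var x) t ∈ L → pair (var y) t ∈ L → x ≡ y
  functional m₁ m₂ with ∈-map⁻ (uncurry row) m₁ | ∈-map⁻ (uncurry row) m₂
  ... | (_ , l₁) , r₁∈ , e₁ | (_ , l₂) , r₂∈ , e₂ with wide r₁∈ | wide r₂∈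
  ... | x₁ , xs₁ , refl , len₁ | x₂ , xs₂ , refl , len₂
    with pair-var-injective (trans e₁ (row-∷ x₁ xs₁ l₁))
       | pair-var-injective (trans e₂ (row-∷ x₂ xs₂ l₂))
  ... | refl , t≡₁ | refl , t≡₂
    with unique-map-injective distinct r₁∈ r₂∈
           (row-injectiveʳ xs₁ xs₂ (trans len₁ (sym len₂)) (trans (sym t≡₁) t≡₂))
  ... | refl = refl

OD-rows-^suc : ∀ {A} k Rs → Width k Rs → Unique (map proj₂ Rs) → OD A (map proj₂ Rs) →
               OD (A ^ suc k) (map (uncurry row) Rs)
OD-rows-^suc {A} k Rs ws distinct oA =
  subst (λ C → OD C (map (uncurry row) Rs)) (^-▸-self A k) (OD-rows k Rs ws distinct oA)

OD-npos : ∀ n → OD npos (z₀ ∷ fold (inr (var n)) ∷ [])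
OD-npos n = OD-μ (OD-⊕ OD-unit (OD-var n))

OD-Z : ∀ z → OD Z (inl unit ∷ inr (inl (var z)) ∷ inr (inr (var z)) ∷ [])
OD-Z z = OD-⊕ OD-unit (OD-⊕ (OD-var z) (OD-var z))

-- Typing the encodings

reverseClause : Val × Expr → Val × Expr
reverseClause (v , e) = valOf e , ret v

tyRet⁻¹ : ∀ {Δ Ψ v C} → ETy Δ Ψ (ret v) C → VTy Δ v C
tyRet⁻¹ (tyRet v⊢) = v⊢

⊢ω-reverse : ∀ {Ψ cs A B} → All (λ c → proj₂ c ≡ ret (valOf (proj₂ c))) cs →
             ITy Ψ (clauses cs) A B → ITy Ψ (clauses (map reverseClause cs)) B A
⊢ω-reverse {Ψ} {cs} {A} {B} letFree (tyClauses typing odA odB) =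
  tyClauses typing′ (subst (OD B) (map-∘ cs) odB) (subst (OD A) (map-∘ cs) odA)
  where
  typing′ : ∀ {v e} → (v , e) ∈ map reverseClause cs → Σ Ctx λ Δ → VTy Δ v B × ETy Δ Ψ e A
  typing′ m with ∈-map⁻ reverseClause m
  ... | c , c∈ , refl with typing c∈
  ... | Δ , v⊢ , e⊢ = Δ , tyRet⁻¹ (subst (λ e → ETy Δ Ψ e B) (All.lookup letFree c∈) e⊢) , tyRet v⊢

Typed : ∀ {k} → RPP k → Set
Typed {k} f = ITy nothing (isos f) (Z ^ k) (Z ^ k)

⊢ω-Id : Typed Id
⊢ω-Id = tyClauses (λ { (here refl) → _ , tyVar , tyRet tyVar ; (there ()) }) (OD-var _) (OD-var _)

⊢ω-𝓧 : Typed 𝓧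
⊢ω-𝓧 = tyClauses
  (λ { (here refl) → _ , varTup-typed (x ∷ y ∷ []) refl u ,
                         tyRet (tyPair (consʳ (consˡ interleave-[]ˡ)) u tyVar tyVar)
     ; (there ()) })
  (OD-varTup (x ∷ y ∷ []) refl) (OD-varTup (y ∷ x ∷ []) refl)
  where
  x y : Name
  x = 0 , 0
  y = 1 , 0
  u : UniqueNames ((x , Z) ∷ (y , Z) ∷ [])
  u = ((λ ()) ∷ []) ∷ [] ∷ []

⊢ω-Sign : Typed Sign
⊢ω-Sign = tyClauses
  (λ { (here refl) → _ , tyInr (tyInl tyVar) , tyRet (tyInr (tyInr tyVar))
     ; (there (here refl)) → _ , tyInr (tyInr tyVar) , tyRet (tyInr (tyInl tyVar))
     ; (there (there (here refl))) → _ , tyInl tyUnit , tyRet (tyInl tyUnit)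
     ; (there (there (there ()))) })
  (OD-resp-↭ (↭-sym (shift _ (_ ∷ _ ∷ []) [])) (OD-Z _))
  (OD-resp-↭ (↭-sym (↭-reverse _)) (OD-Z _))

⊢ω-S : Typed S
⊢ω-S = tyClauses
  (λ { (here refl) → _ , tyInl tyUnit , tyRet (tyInr (tyInl (tyFold (tyInl tyUnit))))
     ; (there (here refl)) → _ , tyInr (tyInl tyVar) , tyRet (tyInr (tyInl (tyFold (tyInr tyVar))))
     ; (there (there (here refl))) → _ , tyInr (tyInr (tyFold (tyInl tyUnit))) , tyRet (tyInl tyUnit)
     ; (there (there (there (here refl)))) →
         _ , tyInr (tyInr (tyFold (tyInr tyVar))) , tyRet (tyInr (tyInr tyVar))
     ; (there (there (there (there ())))) })
  (OD-⊕ OD-unit (OD-⊕ (OD-var _) (OD-npos _)))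
  (OD-resp-↭ (↭-sym (shift _ (_ ∷ _ ∷ []) (_ ∷ []))) (OD-⊕ OD-unit (OD-⊕ (OD-npos _) (OD-var _))))

⊢ω-P : Typed P
⊢ω-P = ⊢ω-reverse (refl ∷ refl ∷ refl ∷ refl ∷ []) ⊢ω-S

⊢ω-⨾ : ∀ {m} (f g : RPP (suc m)) → Typed f → Typed g → Typed (f ⨾ g)
⊢ω-⨾ {m} f g ⊢f ⊢g = tyClauses
  (λ { (here refl) → varCtx Z (vars 0 K) , vars-typed 0 ,
         ⊢let-vars 0 1 m (appClosed ⊢f) interleave-[]ʳ (unique 0) interleave-[]ˡ (unique 1)
           (⊢let-vars 1 2 m (appClosed ⊢g) interleave-[]ʳ (unique 1) interleave-[]ˡ (unique 2)
             (tyRet (vars-typed 2)))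
     ; (there ()) })
  (OD-varTup (vars 0 K) (length-vars 0 K)) (OD-varTup (vars 2 K) (length-vars 2 K))
  where
  K = suc m
  unique : ∀ t → UniqueNames (varCtx Z (vars t K))
  unique t = varCtx-unique (vars-unique t K)
  vars-typed : ∀ t → VTy (varCtx Z (vars t K)) (varTup (vars t K)) (Z ^ K)
  vars-typed t = varTup-typed (vars t K) (length-vars t K) (unique t)

⊢ω-∥ : ∀ {a b} (f : RPP (suc a)) (g : RPP (suc b)) → Typed f → Typed g → Typed (f ∥ g)
⊢ω-∥ {a} {b} f g ⊢f ⊢g = tyClauses
  (λ { (here refl) → varCtx Z (xs ++ ys) , varTup-typed (xs ++ ys) len₀₁ u₀₁ ,
         ⊢let-vars 0 2 a (appClosed ⊢f) (varCtx-++-interleave xs ys) u₀₁ (swap interleave-++) u₂₁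
           (⊢let-vars 1 3 b (appClosed ⊢g) (swap interleave-++) u₂₁ (varCtx-++-interleave xs′ ys′) u₂₃
             (tyRet (varTup-typed (xs′ ++ ys′) len₂₃ u₂₃)))
     ; (there ()) })
  (OD-varTup (xs ++ ys) len₀₁) (OD-varTup (xs′ ++ ys′) len₂₃)
  where
  xs = vars 0 (suc a) ; ys = vars 1 (suc b) ; xs′ = vars 2 (suc a) ; ys′ = vars 3 (suc b)
  len₀₁ = length-vars-++ 0 1 (suc a) (suc b)
  len₂₃ = length-vars-++ 2 3 (suc a) (suc b)
  u₀₁ : UniqueNames (varCtx Z (xs ++ ys))
  u₀₁ = varCtx-unique (vars-++-unique {0} {1} (λ ()) (suc a) (suc b))
  u₂₁ : UniqueNames (varCtx Z xs′ ++ varCtx Z ys)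
  u₂₁ = varCtx-vars-unique 2 1 (λ ()) (suc a) (suc b)
  u₂₃ : UniqueNames (varCtx Z (xs′ ++ ys′))
  u₂₃ = varCtx-unique (vars-++-unique {2} {3} (λ ()) (suc a) (suc b))

AllCalls-let-isos : ∀ {k} (f : RPP k) {Q p q e} → AllCalls Q e → AllCalls Q (lett p (isos f) q e)
AllCalls-let-isos S calls = calls
AllCalls-let-isos P calls = calls
AllCalls-let-isos Id calls = calls
AllCalls-let-isos Sign calls = calls
AllCalls-let-isos 𝓧 calls = calls
AllCalls-let-isos (f ⨾ g) calls = calls
AllCalls-let-isos (f ∥ g) calls = calls
AllCalls-let-isos (It f) calls = calls
AllCalls-let-isos (If f g h) calls = calls

∷ʳ-asVec : ∀ {X : Set} {n} (L : List X) x → length L ≡ n →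
           Σ (Vec X (suc n)) λ v → toList v ≡ L ∷ʳ x × lookup v (fromℕ n) ≡ x
∷ʳ-asVec [] x refl = x Vec.∷ Vec.[] , refl , refl
∷ʳ-asVec (a ∷ L) x refl =
  let (v , v≡ , last≡) = ∷ʳ-asVec L x refl in a Vec.∷ v , cong (a ∷_) v≡ , last≡

ωaux-clauses : ∀ {k} → RPP k → List (Val × Expr)
ωaux-clauses {k} f =
    (row xs z₀ , lett (tupP ys) (isos f) (tupP xs) (ret (row ys z₀)))
  ∷ (row xs (fold (inr (var n))) ,
      lett (tupP ys) (isos f) (tupP xs)
        (lett (tupP (zs ∷ʳ n′)) ivar (tupP (ys ∷ʳ n)) (ret (row zs (fold (inr (var n′)))))))
  ∷ []
  where
  xs = vars 0 k ; ys = vars 1 k ; zs = vars 2 k ; n = (4 , 0) ; n′ = (5 , 0)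

ωaux-structural : ∀ {m} (f : RPP (suc m)) → StructRec (clauses (ωaux-clauses f)) (Z ^ suc m ▸ npos)
ωaux-structural {m} f =
  K , proj₁ types , cong tyTup (sym (proj₁ (proj₂ types))) , fromℕ K ,
  subst IsMu (sym (proj₂ (proj₂ types))) tt , clause
  where
  K = suc m
  types = ∷ʳ-asVec (replicate K Z) npos (length-replicate K)
  values : ∀ l → Σ (Vec Val (suc K)) λ v → toList v ≡ map var (vars 0 K) ∷ʳ l × lookup v (fromℕ K) ≡ l
  values l = ∷ʳ-asVec (map var (vars 0 K)) l (trans (length-map var (vars 0 K)) (length-vars 0 K))
  clause : ∀ {v e} → (v , e) ∈ ωaux-clauses f → _
  clause (here refl) =
    let (vs₀ , vs₀≡ , last≡) = values z₀ in
    vs₀ , cong tupV (sym vs₀≡) , inj₁ (subst Closed (sym last≡) tt , AllCalls-let-isos f tt)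
  clause (there (here refl)) =
    let (vs₀ , vs₀≡ , last≡) = values (fold (inr (var (4 , 0))))
        (ns , ns≡ , lastName≡) = ∷ʳ-asVec (vars 1 K) (4 , 0) (length-vars 1 K) in
    vs₀ , cong tupV (sym vs₀≡) ,
    inj₂ (AllCalls-let-isos f
      ((ns , cong tupP (sym ns≡) ,
        subst₂ StrictSub (cong var (sym lastName≡)) (sym last≡) (ss-f (inSub-r here))) , tt))
  clause (there (there ()))

⊢ω-aux : ∀ {m} (f : RPP (suc m)) → Typed f →
         ITy nothing (fix (clauses (ωaux-clauses f))) (Z ^ suc m ▸ npos) (Z ^ suc m ▸ npos)
⊢ω-aux {m} f ⊢f = tyFix
  (tyClauses typing
    (OD-rows K ((vars 0 K , z₀) ∷ (vars 0 K , fold (inr (var n))) ∷ [])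
      (length-vars 0 K ∷ length-vars 0 K ∷ []) distinct (OD-npos n))
    (OD-rows K ((vars 1 K , z₀) ∷ (vars 2 K , fold (inr (var n′))) ∷ [])
      (length-vars 1 K ∷ length-vars 2 K ∷ []) distinct (OD-npos n′)))
  (ωaux-structural f)
  where
  K = suc m
  n n′ : Name
  n = 4 , 0
  n′ = 5 , 0
  A = Z ^ K ▸ npos
  distinct : ∀ {a} → Unique (z₀ ∷ fold (inr (var a)) ∷ [])
  distinct = ((λ ()) ∷ []) ∷ [] ∷ []
  typing : ∀ {v e} → (v , e) ∈ ωaux-clauses f → Σ Ctx λ Δ → VTy Δ v A × ETy Δ (just (A , A)) e A
  typing (here refl) = _ , vars-row-typed 0 K z₀⊢ u₀ ,
    ⊢let-vars 0 1 m (appClosed ⊢f) interleave-++ u₀ (swap interleave-++) u₁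
      (tyRet (vars-row-typed 1 K z₀⊢ u₁))
    where
    z₀⊢ = tyFold (tyInl tyUnit)
    u₀ = varCtx-vars-unique {B = npos} 0 4 (λ ()) K 0
    u₁ = varCtx-vars-unique {B = npos} 1 4 (λ ()) K 0
  typing (there (here refl)) = _ , vars-row-typed 0 K (tyFold (tyInr tyVar)) u₀ ,
    ⊢let-vars 0 1 m (appClosed ⊢f) interleave-++ u₀ (swap interleave-++) u₁
      (tyLet interleave-[]ʳ u₁ (vars-∷ʳ-pat-typed 1 K n u₁) appVar
        (vars-∷ʳ-pat-typed 2 K n′ u₂) interleave-[]ˡ u₂
        (tyRet (vars-row-typed 2 K (tyFold (tyInr tyVar)) u₂)))
    where
    u₀ = varCtx-vars-unique 0 4 (λ ()) K 1
    u₁ = varCtx-vars-unique 1 4 (λ ()) K 1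
    u₂ = varCtx-vars-unique 2 5 (λ ()) K 1
  typing (there (there ()))

⊢ω-It : ∀ {m} (f : RPP (suc m)) → Typed f → Typed (It f)
⊢ω-It {m} f ⊢f = tyClauses
  (λ { (here refl) → _ , zero⊢ , tyRet zero⊢
     ; (there (here refl)) → counter (λ v → inr (inl v)) (tyInr (tyInl tyVar))
     ; (there (there (here refl))) → counter (λ v → inr (inr v)) (tyInr (tyInr tyVar))
     ; (there (there (there ()))) })
  (OD-rows-^suc K ((xs , inl unit) ∷ (xs , inr (inl (var z))) ∷ (xs , inr (inr (var z))) ∷ [])
    (length-vars 0 K ∷ length-vars 0 K ∷ length-vars 0 K ∷ []) distinct (OD-Z z))
  (OD-rows-^suc K ((xs , inl unit) ∷ (ys , inr (inl (var z′))) ∷ (ys , inr (inr (var z′))) ∷ [])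
    (length-vars 0 K ∷ length-vars 1 K ∷ length-vars 1 K ∷ []) distinct (OD-Z z′))
  where
  K = suc m
  xs = vars 0 K ; ys = vars 1 K
  z z′ : Name
  z = 2 , 0
  z′ = 3 , 0
  distinct : ∀ {a} → Unique (inl unit ∷ inr (inl (var a)) ∷ inr (inr (var a)) ∷ [])
  distinct = ((λ ()) ∷ (λ ()) ∷ []) ∷ ((λ ()) ∷ []) ∷ [] ∷ []
  zero⊢ : VTy (varCtx Z xs ++ []) (row xs (inl unit)) (Z ^ suc K)
  zero⊢ = vars-row-typed-^suc 0 K (tyInl tyUnit) (varCtx-vars-unique {B = npos} 0 2 (λ ()) K 0)
  counter : (c : Val → Val) → (∀ {x} → VTy ((x , npos) ∷ []) (c (var x)) Z) →
            Σ Ctx λ Δ → VTy Δ (row xs (c (var z))) (Z ^ suc K) ×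
              ETy Δ nothing (lett (tupP (ys ∷ʳ z′)) (fix (clauses (ωaux-clauses f))) (tupP (xs ∷ʳ z))
                               (ret (row ys (c (var z′))))) (Z ^ suc K)
  counter c c⊢ = _ , vars-row-typed-^suc 0 K c⊢ u₀ ,
    tyLet interleave-[]ʳ u₀ (vars-∷ʳ-pat-typed 0 K z u₀) (appClosed (⊢ω-aux f ⊢f))
      (vars-∷ʳ-pat-typed 1 K z′ u₁) interleave-[]ˡ u₁ (tyRet (vars-row-typed-^suc 1 K c⊢ u₁))
    where
    u₀ = varCtx-vars-unique 0 2 (λ ()) K 1
    u₁ = varCtx-vars-unique 1 3 (λ ()) K 1

⊢ω-If : ∀ {m} (f g h : RPP (suc m)) → Typed f → Typed g → Typed h → Typed (If f g h)
⊢ω-If {m} f g h ⊢f ⊢g ⊢h = tyClauses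
  (λ { (here refl) → branch 1 ⊢f (tyInr (tyInl tyVar))
     ; (there (here refl)) → branch 0 ⊢g (tyInl tyUnit)
     ; (there (there (here refl))) → branch 1 ⊢h (tyInr (tyInr tyVar))
     ; (there (there (there ()))) })
  (OD-rows-^suc K (rows 0) (width 0) distinct signs)
  (OD-rows-^suc K (rows 1) (width 1) distinct signs)
  where
  K = suc m
  xs = vars 0 K ; xs′ = vars 1 K
  z : Name
  z = 2 , 0
  rows : ℕ → List Row
  rows t = (vars t K , inr (inl (var z))) ∷ (vars t K , inl unit) ∷ (vars t K , inr (inr (var z))) ∷ []
  width : ∀ t → Width K (rows t)
  width t = length-vars t K ∷ length-vars t K ∷ length-vars t K ∷ []
  distinct : Unique (map proj₂ (rows 0))
  distinct = ((λ ()) ∷ (λ ()) ∷ []) ∷ ((λ ()) ∷ []) ∷ [] ∷ []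
  signs : OD Z (map proj₂ (rows 0))
  signs = OD-resp-↭ (shift _ (_ ∷ []) (_ ∷ [])) (OD-Z z)
  branch : ∀ {ω l} j → ITy nothing ω (Z ^ K) (Z ^ K) → VTy (varCtx npos (vars 2 j)) l Z →
           Σ Ctx λ Δ → VTy Δ (row xs l) (Z ^ suc K) ×
             ETy Δ nothing (lett (tupP xs′) ω (tupP xs) (ret (row xs′ l))) (Z ^ suc K)
  branch j ⊢ω l⊢ = _ , vars-row-typed-^suc 0 K l⊢ u₀ ,
    ⊢let-vars 0 1 m (appClosed ⊢ω) interleave-++ u₀ (swap interleave-++) u₁
      (tyRet (vars-row-typed-^suc 1 K l⊢ u₁))
    where
    u₀ = varCtx-vars-unique 0 2 (λ ()) K j
    u₁ = varCtx-vars-unique 1 2 (λ ()) K j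

mainTheorem8 : (k : ℕ) (f : RPP k) → ITy nothing (isos f) (Zpow k) (Zpow k)
mainTheorem8 _ S = ⊢ω-S
mainTheorem8 _ P = ⊢ω-P
mainTheorem8 _ Id = ⊢ω-Id
mainTheorem8 _ Sign = ⊢ω-Sign
mainTheorem8 _ 𝓧 = ⊢ω-𝓧
mainTheorem8 _ (f ⨾ g) with arity-suc f
... | _ , refl = ⊢ω-⨾ f g (mainTheorem8 _ f) (mainTheorem8 _ g)
mainTheorem8 _ (f ∥ g) with arity-suc f | arity-suc g
... | _ , refl | _ , refl = ⊢ω-∥ f g (mainTheorem8 _ f) (mainTheorem8 _ g)
mainTheorem8 _ (It f) with arity-suc f
... | _ , refl = ⊢ω-It f (mainTheorem8 _ f)
mainTheorem8 _ (If f g h) with arity-suc f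
... | _ , refl = ⊢ω-If f g h (mainTheorem8 _ f) (mainTheorem8 _ g) (mainTheorem8 _ h)
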